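{- Let $K$ be a field and let $f$ be a hypergeometric term on $\mathbb{Z}^k$ over $K$ that is a zero divisor. Then there exist, for each $\mathbf v\in\mathbb{Z}^k$, nonzero polynomials $A_{\mathbf v},B_{\mathbf v}\in K[z_1,\ldots,z_k]$ such that $A_{\mathbf v}f=B_{\mathbf v}f^{\mathbf v}$, and such that the rational functions $R_{\mathbf v}=A_{\mathbf v}/B_{\mathbf v}$ satisfy $R_{\mathbf v}R_{\mathbf w}^{\mathbf v}=R_{\mathbf w}R_{\mathbf v}^{\mathbf w}$ for all $\mathbf v,\mathbf w\in\mathbb{Z}^k$.
   Context: For a function, polynomial or rational function $g$ on $\mathbb{Z}^k$ and $\mathbf v\in\mathbb{Z}^k$, $g^{\mathbf v}(\mathbf z)=g(\mathbf z+\mathbf v)$; products $pf$ are pointwise; $\mathbf e_i$ is the $i$-th unit vector. A hypergeometric term on $\mathbb{Z}^k$ over $K$ is a function $f\colon\mathbb{Z}^k\to K$ such that for each $i$ there are nonzero $A_i,B_i\in K[\mathbf z]$ with $A_i(\mathbf z)f(\mathbf z)=B_i(\mathbf z)f(\mathbf z+\mathbf e_i)$ for all $\mathbf z$. $f$ is a zero divisor if $pf=0$ for some nonzero $p\in K[\mathbf z]$. -}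

module Defs where

open import Level using (Level; _⊔_)
open import Algebra.Bundles using (CommutativeRing)
open import Data.Nat using (ℕ; zero; suc)
open import Data.Integer as ℤ using (ℤ; +_; -[1+_])
open import Data.Fin using (Fin)
open import Data.Vec using (Vec; []; _∷_; zipWith; replicate; map; _[_]≔_)
open import Data.List using (List; []; _∷_)
import Data.List
open import Data.Product using (Σ; ∃; _×_; _,_)
open import Data.Unit.Polymorphic using (⊤)
open import Relation.Nullary using (¬_)

record Field (c ℓ : Level) : Set (Level.suc (c ⊔ ℓ)) where
  field
    commutativeRing : CommutativeRing c ℓ
  open CommutativeRing commutativeRing public
  field
    1≉0     : ¬ (1# ≈ 0#)
    inverse : ∀ x → ¬ (x ≈ 0#) → Σ Carrier (λ y → (x * y) ≈ 1#)

module FieldPoly {c ℓ : Level} (K : Field c ℓ) where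
  open Field K using (Carrier; _≈_; _+_; _*_; -_; 0#; 1#)

  ιℕ : ℕ → Carrier
  ιℕ zero    = 0#
  ιℕ (suc n) = 1# + ιℕ n

  ι : ℤ → Carrier
  ι (+ n)      = ιℕ n
  ι -[1+ n ]   = - (1# + ιℕ n)

  -- K[z₁,…,z_k], recursively: a polynomial in k+1 variables is a polynomial
  -- in z₁ with coefficients in K[z₂,…,z_{k+1}], given by its (dense) list of
  -- coefficients, lowest degree first.
  data Poly : ℕ → Set c where
    con  : Carrier → Poly zero
    poly : ∀ {k} → List (Poly k) → Poly (suc k)

  0P : ∀ {k} → Poly k
  0P {zero}  = con 0#
  0P {suc k} = poly []

  constP : ∀ {k} → Carrier → Poly k
  constP {zero}  x = con x
  constP {suc k} x = poly (constP x ∷ [])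

  infix 4 _≈P_ _≈L_
  mutual
    _≈P_ : ∀ {k} → Poly k → Poly k → Set ℓ
    con x  ≈P con y  = x ≈ y
    poly p ≈P poly q = p ≈L q

    _≈L_ : ∀ {k} → List (Poly k) → List (Poly k) → Set ℓ
    []       ≈L []       = ⊤
    []       ≈L (b ∷ bs) = (0P ≈P b) × ([] ≈L bs)
    (a ∷ as) ≈L []       = (a ≈P 0P) × (as ≈L [])
    (a ∷ as) ≈L (b ∷ bs) = (a ≈P b) × (as ≈L bs)

  NonzeroP : ∀ {k} → Poly k → Set ℓ
  NonzeroP p = ¬ (p ≈P 0P)

  infixl 6 _+P_ _+L_
  infixl 7 _*P_ _*L_
  mutual
    _+P_ : ∀ {k} → Poly k → Poly k → Poly k
    con x  +P con y  = con (x + y)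
    poly p +P poly q = poly (p +L q)

    _+L_ : ∀ {k} → List (Poly k) → List (Poly k) → List (Poly k)
    []       +L q        = q
    (a ∷ as) +L []       = a ∷ as
    (a ∷ as) +L (b ∷ bs) = (a +P b) ∷ (as +L bs)

  mutual
    _*P_ : ∀ {k} → Poly k → Poly k → Poly k
    con x  *P con y  = con (x * y)
    poly p *P poly q = poly (p *L q)

    _*L_ : ∀ {k} → List (Poly k) → List (Poly k) → List (Poly k)
    []       *L q = []
    (a ∷ as) *L q = scale a q +L (0P ∷ (as *L q))

    scale : ∀ {k} → Poly k → List (Poly k) → List (Poly k)
    scale a []       = []
    scale a (b ∷ bs) = (a *P b) ∷ scale a bs

  -- substitution z₁ ↦ z₁ + c in a coefficient list (Horner scheme)
  taylor : ∀ {k} → Carrier → List (Poly k) → List (Poly k)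
  taylor c []       = []
  taylor c (a ∷ as) = (a ∷ []) +L ((constP c ∷ constP 1# ∷ []) *L taylor c as)

  mutual
    shiftP : ∀ {k} → Poly k → Vec ℤ k → Poly k
    shiftP (con x)  []       = con x
    shiftP (poly p) (c ∷ vs) = poly (taylor (ι c) (shiftL p vs))

    shiftL : ∀ {k} → List (Poly k) → Vec ℤ k → List (Poly k)
    shiftL []       vs = []
    shiftL (a ∷ as) vs = shiftP a vs ∷ shiftL as vs

  mutual
    evalP : ∀ {k} → Poly k → Vec Carrier k → Carrier
    evalP (con x)  []       = x
    evalP (poly p) (x ∷ xs) = evalL p x xs

    evalL : ∀ {k} → List (Poly k) → Carrier → Vec Carrier k → Carrier
    evalL []       x xs = 0#
    evalL (a ∷ as) x xs = evalP a xs + x * evalL as x xs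

  evalℤ : ∀ {k} → Poly k → Vec ℤ k → Carrier
  evalℤ p z = evalP p (map ι z)

  _+ᵛ_ : ∀ {k} → Vec ℤ k → Vec ℤ k → Vec ℤ k
  _+ᵛ_ = zipWith ℤ._+_

  e : ∀ {k} → Fin k → Vec ℤ k
  e {k} i = replicate k (+ 0) [ i ]≔ (+ 1)

  Relates : ∀ {k} → (Vec ℤ k → Carrier) → Poly k → Poly k → Vec ℤ k → Set ℓ
  Relates f A B v = ∀ z → (evalℤ A z * f z) ≈ (evalℤ B z * f (z +ᵛ v))

  IsHypergeometric : ∀ {k} → (Vec ℤ k → Carrier) → Set (c ⊔ ℓ)
  IsHypergeometric {k} f = (i : Fin k) →
    Σ (Poly k) λ A → Σ (Poly k) λ B → NonzeroP A × NonzeroP B × Relates f A B (e i)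

  IsZeroDivisor : ∀ {k} → (Vec ℤ k → Carrier) → Set (c ⊔ ℓ)
  IsZeroDivisor {k} f =
    Σ (Poly k) λ p → NonzeroP p × (∀ z → (evalℤ p z * f z) ≈ 0#)

  -- R_v R_w^v = R_w R_v^w for R_u = A_u / B_u, as an identity in K(z)
  -- (i.e. after clearing the nonzero denominators B_v B_w^v B_w B_v^w):
  -- A_v A_w^v B_w B_v^w = A_w A_v^w B_v B_w^v in K[z].
  Compatible : ∀ {k} → (Vec ℤ k → Poly k) → (Vec ℤ k → Poly k) → Set ℓ
  Compatible {k} A B = ∀ v w →
    (A v *P (shiftP (A w) v *P (B w *P shiftP (B v) w)))
      ≈P (A w *P (shiftP (A v) w *P (B v *P shiftP (B w) v)))

-- If p f = 0 with p ≠ 0, then A_v = B_v = p·p^v annihilates both f and f^v,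
-- so A_v f = 0 = B_v f^v for every v; taking A = B makes the compatibility
-- identity an instance of commutativity and associativity in K[z].  The only
-- real work is that A_v ≠ 0: K[z] has no zero divisors, and a shift p^v can
-- only vanish if p does, because in the Horner form of the substitution
-- z₁ ↦ z₁ + c the monic factor z₁ + c cancels one coefficient at a time.
module Submission where

open import Defs
open import Level using (Level; _⊔_)
open import Algebra.Structures using (IsCommutativeSemiring)
open import Algebra.Bundles using (CommutativeSemigroup)
import Algebra.Properties.CommutativeSemigroup as CommutativeSemigroupProperties
open import Algebra.Structures.Biased using (isCommutativeSemiringˡ; isCommutativeMonoidˡ)
open import Algebra.Properties.AbelianGroup using (⁻¹-∙-comm)
open import Algebra.Properties.Group using (ε⁻¹≈ε)
open import Data.Nat using (ℕ; zero; suc)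
import Data.Nat as ℕ
import Data.Nat.Properties as ℕ
open import Data.Integer as ℤ using (ℤ; +_; -[1+_]; _⊖_)
import Data.Integer.Properties as ℤ
open import Data.List using (List; []; _∷_)
open import Data.Vec using (Vec; []; _∷_; zipWith; map)
open import Data.Vec.Relation.Binary.Pointwise.Inductive using (Pointwise; []; _∷_)
open import Data.Product using (Σ; _×_; _,_)
open import Data.Unit.Polymorphic using (tt)
open import Relation.Binary.Bundles using (Setoid)
open import Relation.Binary.Structures using (IsEquivalence)
import Relation.Binary.PropositionalEquality as ≡
import Relation.Binary.Reasoning.Setoid as SetoidReasoning
open import Relation.Nullary using (¬_)

module _ {c ℓ : Level} (K : Field c ℓ) where
  open FieldPoly K
  module F = Field K
  open F using (Carrier; 0#; 1#)

  -- _≈P_ computes by recursion on its arguments and so cannot be used to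
  -- infer them; this record wrapper is injective.
  infix 4 _≋_
  record _≋_ {k} (p q : Poly k) : Set ℓ where
    constructor ≈P⇒≋
    field ≋⇒≈P : p ≈P q
  open _≋_

  z+_ : ∀ {k} → Carrier → List (Poly k)
  z+ a = constP a ∷ constP 1# ∷ []

  IsPolySemiring : ℕ → Set (c ⊔ ℓ)
  IsPolySemiring k = IsCommutativeSemiring (_≋_ {k}) _+P_ _*P_ 0P (constP 1#)

  NoZeroDivisors : ℕ → Set (c ⊔ ℓ)
  NoZeroDivisors k = ∀ {p q : Poly k} → ¬ p ≋ 0P → ¬ q ≋ 0P → ¬ (p *P q) ≋ 0P

  field-noZeroDivisors : ∀ {x y} → ¬ x F.≈ 0# → ¬ y F.≈ 0# → ¬ (x F.* y) F.≈ 0#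
  field-noZeroDivisors {x} {y} x≉0 y≉0 xy≈0 with F.inverse x x≉0
  ... | x⁻¹ , xx⁻¹≈1 = y≉0 (begin
    y                  ≈⟨ F.*-identityˡ y ⟨
    1# F.* y           ≈⟨ F.*-congʳ (F.trans (F.*-comm x⁻¹ x) xx⁻¹≈1) ⟨
    x⁻¹ F.* x F.* y    ≈⟨ F.*-assoc x⁻¹ x y ⟩
    x⁻¹ F.* (x F.* y)  ≈⟨ F.*-congˡ xy≈0 ⟩
    x⁻¹ F.* 0#         ≈⟨ F.zeroʳ x⁻¹ ⟩
    0#                 ∎)
    where open SetoidReasoning F.setoid

  constant-isEquivalence : IsEquivalence (_≋_ {zero})
  constant-isEquivalence = record
    { refl  = λ { {con x} → ≈P⇒≋ F.refl }
    ; sym   = λ { {con x} {con y} (≈P⇒≋ e) → ≈P⇒≋ (F.sym e) }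
    ; trans = λ { {con x} {con y} {con z} (≈P⇒≋ e) (≈P⇒≋ e') → ≈P⇒≋ (F.trans e e') }
    }

  constant-isPolySemiring : IsPolySemiring zero
  constant-isPolySemiring = isCommutativeSemiringˡ record
    { +-isCommutativeMonoid = isCommutativeMonoidˡ record
      { isSemigroup = record
        { isMagma = record
          { isEquivalence = constant-isEquivalence
          ; ∙-cong = λ { {con _} {con _} {con _} {con _} (≈P⇒≋ e) (≈P⇒≋ e') → ≈P⇒≋ (F.+-cong e e') }
          }
        ; assoc = λ { (con x) (con y) (con z) → ≈P⇒≋ (F.+-assoc x y z) }
        }
      ; identityˡ = λ { (con x) → ≈P⇒≋ (F.+-identityˡ x) }
      ; comm = λ { (con x) (con y) → ≈P⇒≋ (F.+-comm x y) }
      }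
    ; *-isCommutativeMonoid = isCommutativeMonoidˡ record
      { isSemigroup = record
        { isMagma = record
          { isEquivalence = constant-isEquivalence
          ; ∙-cong = λ { {con _} {con _} {con _} {con _} (≈P⇒≋ e) (≈P⇒≋ e') → ≈P⇒≋ (F.*-cong e e') }
          }
        ; assoc = λ { (con x) (con y) (con z) → ≈P⇒≋ (F.*-assoc x y z) }
        }
      ; identityˡ = λ { (con x) → ≈P⇒≋ (F.*-identityˡ x) }
      ; comm = λ { (con x) (con y) → ≈P⇒≋ (F.*-comm x y) }
      }
    ; distribʳ = λ { (con x) (con y) (con z) → ≈P⇒≋ (F.distribʳ x y z) }
    ; zeroˡ = λ { (con x) → ≈P⇒≋ (F.zeroˡ x) }
    }

  constant-noZeroDivisors : NoZeroDivisors zero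
  constant-noZeroDivisors {con x} {con y} x≉0 y≉0 (≈P⇒≋ xy≈0) =
    field-noZeroDivisors (λ e → x≉0 (≈P⇒≋ e)) (λ e → y≉0 (≈P⇒≋ e)) xy≈0

  infix 4 _≋L_
  data _≋L_ {k} : List (Poly k) → List (Poly k) → Set (c ⊔ ℓ) where
    []  : [] ≋L []
    []≋ : ∀ {b bs} → 0P ≋ b → [] ≋L bs → [] ≋L (b ∷ bs)
    ≋[] : ∀ {a as} → a ≋ 0P → as ≋L [] → (a ∷ as) ≋L []
    _∷_ : ∀ {a as b bs} → a ≋ b → as ≋L bs → (a ∷ as) ≋L (b ∷ bs)

  ≈L⇒≋L : ∀ {k} {xs ys : List (Poly k)} → xs ≈L ys → xs ≋L ys
  ≈L⇒≋L {xs = []}     {[]}     _        = []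
  ≈L⇒≋L {xs = []}     {y ∷ ys} (e , es) = []≋ (≈P⇒≋ e) (≈L⇒≋L es)
  ≈L⇒≋L {xs = x ∷ xs} {[]}     (e , es) = ≋[] (≈P⇒≋ e) (≈L⇒≋L es)
  ≈L⇒≋L {xs = x ∷ xs} {y ∷ ys} (e , es) = ≈P⇒≋ e ∷ ≈L⇒≋L es

  ≋L⇒≈L : ∀ {k} {xs ys : List (Poly k)} → xs ≋L ys → xs ≈L ys
  ≋L⇒≈L []         = tt
  ≋L⇒≈L ([]≋ e es) = ≋⇒≈P e , ≋L⇒≈L es
  ≋L⇒≈L (≋[] e es) = ≋⇒≈P e , ≋L⇒≈L es
  ≋L⇒≈L (e ∷ es)   = ≋⇒≈P e , ≋L⇒≈L es

  poly≋ : ∀ {k} {xs ys : List (Poly k)} → xs ≋L ys → poly xs ≋ poly ys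
  poly≋ e = ≈P⇒≋ (≋L⇒≈L e)

  poly≋⁻¹ : ∀ {k} {xs ys : List (Poly k)} → poly xs ≋ poly ys → xs ≋L ys
  poly≋⁻¹ e = ≈L⇒≋L (≋⇒≈P e)

  module CoefficientLists {k : ℕ} (R : IsPolySemiring k) where
    open IsCommutativeSemiring R

    ≋L-refl : ∀ {xs : List (Poly k)} → xs ≋L xs
    ≋L-refl {[]}     = []
    ≋L-refl {x ∷ xs} = refl ∷ ≋L-refl

    ≋L-sym : ∀ {xs ys : List (Poly k)} → xs ≋L ys → ys ≋L xs
    ≋L-sym []         = []
    ≋L-sym ([]≋ e es) = ≋[] (sym e) (≋L-sym es)
    ≋L-sym (≋[] e es) = []≋ (sym e) (≋L-sym es)
    ≋L-sym (e ∷ es)   = sym e ∷ ≋L-sym es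

    ≋L-trans : ∀ {xs ys zs : List (Poly k)} → xs ≋L ys → ys ≋L zs → xs ≋L zs
    ≋L-trans []         f          = f
    ≋L-trans ([]≋ e es) (≋[] f fs) = []
    ≋L-trans ([]≋ e es) (f ∷ fs)   = []≋ (trans e f) (≋L-trans es fs)
    ≋L-trans (≋[] e es) []         = ≋[] e es
    ≋L-trans (≋[] e es) ([]≋ f fs) = trans e f ∷ ≋L-trans es fs
    ≋L-trans (e ∷ es)   (≋[] f fs) = ≋[] (trans e f) (≋L-trans es fs)
    ≋L-trans (e ∷ es)   (f ∷ fs)   = trans e f ∷ ≋L-trans es fs

    ≋L-isEquivalence : IsEquivalence (_≋L_ {k})
    ≋L-isEquivalence = record { refl = ≋L-refl ; sym = ≋L-sym ; trans = ≋L-trans }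

    ≋L-setoid : Setoid c (c ⊔ ℓ)
    ≋L-setoid = record { isEquivalence = ≋L-isEquivalence }

    +L-identityʳ : ∀ xs → (xs +L []) ≋L xs
    +L-identityʳ []       = []
    +L-identityʳ (x ∷ xs) = ≋L-refl

    +L-comm : ∀ xs ys → (xs +L ys) ≋L (ys +L xs)
    +L-comm []       []       = []
    +L-comm []       (y ∷ ys) = ≋L-refl
    +L-comm (x ∷ xs) []       = ≋L-refl
    +L-comm (x ∷ xs) (y ∷ ys) = +-comm x y ∷ +L-comm xs ys

    +L-assoc : ∀ xs ys zs → ((xs +L ys) +L zs) ≋L (xs +L (ys +L zs))
    +L-assoc []       ys       zs       = ≋L-refl
    +L-assoc (x ∷ xs) []       zs       = ≋L-refl
    +L-assoc (x ∷ xs) (y ∷ ys) []       = ≋L-refl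
    +L-assoc (x ∷ xs) (y ∷ ys) (z ∷ zs) = +-assoc x y z ∷ +L-assoc xs ys zs

    +L-congʳ : ∀ {xs xs'} ys → xs ≋L xs' → (xs +L ys) ≋L (xs' +L ys)
    +L-congʳ ys       []         = ≋L-refl
    +L-congʳ []       ([]≋ e es) = []≋ e es
    +L-congʳ (y ∷ ys) ([]≋ e es) =
      trans (sym (+-identityˡ y)) (+-congʳ e) ∷ +L-congʳ ys es
    +L-congʳ []       (≋[] e es) = ≋[] e es
    +L-congʳ (y ∷ ys) (≋[] e es) = trans (+-congʳ e) (+-identityˡ y) ∷ +L-congʳ ys es
    +L-congʳ []       (e ∷ es)   = e ∷ es
    +L-congʳ (y ∷ ys) (e ∷ es)   = +-congʳ e ∷ +L-congʳ ys es

    +L-cong : ∀ {xs xs' ys ys'} → xs ≋L xs' → ys ≋L ys' → (xs +L ys) ≋L (xs' +L ys')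
    +L-cong {xs} {xs'} {ys} {ys'} e f = begin
      xs +L ys    ≈⟨ +L-congʳ ys e ⟩
      xs' +L ys   ≈⟨ +L-comm xs' ys ⟩
      ys +L xs'   ≈⟨ +L-congʳ xs' f ⟩
      ys' +L xs'  ≈⟨ +L-comm ys' xs' ⟩
      xs' +L ys'  ∎
      where open SetoidReasoning ≋L-setoid

    +L-congˡ : ∀ xs {ys ys'} → ys ≋L ys' → (xs +L ys) ≋L (xs +L ys')
    +L-congˡ xs = +L-cong ≋L-refl

    +L-commutativeSemigroup : CommutativeSemigroup c (c ⊔ ℓ)
    +L-commutativeSemigroup = record
      { isCommutativeSemigroup = record
        { isSemigroup = record
          { isMagma = record { isEquivalence = ≋L-isEquivalence ; ∙-cong = +L-cong }
          ; assoc = +L-assoc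
          }
        ; comm = +L-comm
        }
      }

    open CommutativeSemigroupProperties +L-commutativeSemigroup
      using (interchange; x∙yz≈y∙xz)

    scale-congʳ : ∀ {a a'} xs → a ≋ a' → scale a xs ≋L scale a' xs
    scale-congʳ []       e = []
    scale-congʳ (x ∷ xs) e = *-congʳ e ∷ scale-congʳ xs e

    scale-congˡ : ∀ a {xs ys} → xs ≋L ys → scale a xs ≋L scale a ys
    scale-congˡ a []         = []
    scale-congˡ a ([]≋ e es) = []≋ (trans (sym (zeroʳ a)) (*-congˡ e)) (scale-congˡ a es)
    scale-congˡ a (≋[] e es) = ≋[] (trans (*-congˡ e) (zeroʳ a)) (scale-congˡ a es)
    scale-congˡ a (e ∷ es)   = *-congˡ e ∷ scale-congˡ a es

    scale-zero : ∀ {a} xs → a ≋ 0P → scale a xs ≋L []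
    scale-zero []       e = []
    scale-zero (x ∷ xs) e = ≋[] (trans (*-congʳ e) (zeroˡ x)) (scale-zero xs e)

    scale-distribˡ : ∀ a xs ys → scale a (xs +L ys) ≋L (scale a xs +L scale a ys)
    scale-distribˡ a []       ys       = ≋L-refl
    scale-distribˡ a (x ∷ xs) []       = ≋L-refl
    scale-distribˡ a (x ∷ xs) (y ∷ ys) = distribˡ a x y ∷ scale-distribˡ a xs ys

    scale-distribʳ : ∀ a b xs → scale (a +P b) xs ≋L (scale a xs +L scale b xs)
    scale-distribʳ a b []       = []
    scale-distribʳ a b (x ∷ xs) = distribʳ x a b ∷ scale-distribʳ a b xs

    scale-scale : ∀ a b xs → scale a (scale b xs) ≋L scale (a *P b) xs
    scale-scale a b []       = []
    scale-scale a b (x ∷ xs) = sym (*-assoc a b x) ∷ scale-scale a b xs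

    scale-identity : ∀ xs → scale (constP 1#) xs ≋L xs
    scale-identity []       = []
    scale-identity (x ∷ xs) = *-identityˡ x ∷ scale-identity xs

    *L-zeroʳ : ∀ xs → (xs *L []) ≋L []
    *L-zeroʳ []       = []
    *L-zeroʳ (x ∷ xs) = ≋[] refl (*L-zeroʳ xs)

    *L-congʳ : ∀ {xs xs'} ys → xs ≋L xs' → (xs *L ys) ≋L (xs' *L ys)
    *L-congʳ ys []                   = []
    *L-congʳ ys ([]≋ {b} {bs} e es)  =
      ≋L-sym (+L-cong {ys = 0P ∷ (bs *L ys)} {ys' = []} (scale-zero ys (sym e))
                                                  (≋[] refl (≋L-sym (*L-congʳ ys es))))
    *L-congʳ ys (≋[] {a} {as} e es)  =
      +L-cong {ys = 0P ∷ (as *L ys)} {ys' = []} (scale-zero ys e) (≋[] refl (*L-congʳ ys es))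
    *L-congʳ ys (e ∷ es)             = +L-cong (scale-congʳ ys e) (refl ∷ *L-congʳ ys es)

    *L-∷ : ∀ xs y ys → (xs *L (y ∷ ys)) ≋L (scale y xs +L (0P ∷ (xs *L ys)))
    *L-∷ []       y ys = []≋ refl []
    *L-∷ (x ∷ xs) y ys = +-congʳ (*-comm x y) ∷ (begin
      scale x ys +L (xs *L (y ∷ ys))                       ≈⟨ +L-congˡ (scale x ys) (*L-∷ xs y ys) ⟩
      scale x ys +L (scale y xs +L (0P ∷ (xs *L ys)))      ≈⟨ x∙yz≈y∙xz (scale x ys) (scale y xs) _ ⟩
      scale y xs +L (scale x ys +L (0P ∷ (xs *L ys)))      ∎)
      where open SetoidReasoning ≋L-setoid

    *L-comm : ∀ xs ys → (xs *L ys) ≋L (ys *L xs)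
    *L-comm []       ys = ≋L-sym (*L-zeroʳ ys)
    *L-comm (x ∷ xs) ys =
      ≋L-trans (+L-congˡ (scale x ys) (refl ∷ *L-comm xs ys)) (≋L-sym (*L-∷ ys x xs))

    *L-cong : ∀ {xs xs' ys ys'} → xs ≋L xs' → ys ≋L ys' → (xs *L ys) ≋L (xs' *L ys')
    *L-cong {xs} {xs'} {ys} {ys'} e f = begin
      xs *L ys    ≈⟨ *L-congʳ ys e ⟩
      xs' *L ys   ≈⟨ *L-comm xs' ys ⟩
      ys *L xs'   ≈⟨ *L-congʳ xs' f ⟩
      ys' *L xs'  ≈⟨ *L-comm ys' xs' ⟩
      xs' *L ys'  ∎
      where open SetoidReasoning ≋L-setoid

    *L-distribʳ : ∀ xs ys zs → ((xs +L ys) *L zs) ≋L ((xs *L zs) +L (ys *L zs))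
    *L-distribʳ []       ys       zs = ≋L-refl
    *L-distribʳ (x ∷ xs) []       zs = ≋L-sym (+L-identityʳ ((x ∷ xs) *L zs))
    *L-distribʳ (x ∷ xs) (y ∷ ys) zs =
      ≋L-trans (+L-cong (scale-distribʳ x y zs) (sym (+-identityˡ 0P) ∷ *L-distribʳ xs ys zs))
               (interchange (scale x zs) (scale y zs) (0P ∷ (xs *L zs)) (0P ∷ (ys *L zs)))

    0∷-*L : ∀ xs ys → ((0P ∷ xs) *L ys) ≋L (0P ∷ (xs *L ys))
    0∷-*L xs ys = +L-congʳ (0P ∷ (xs *L ys)) (scale-zero ys refl)

    scale-*L : ∀ a xs ys → (scale a xs *L ys) ≋L scale a (xs *L ys)
    scale-*L a []       ys = []
    scale-*L a (x ∷ xs) ys =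
      ≋L-trans (+L-cong (≋L-sym (scale-scale a x ys)) (sym (zeroʳ a) ∷ scale-*L a xs ys))
               (≋L-sym (scale-distribˡ a (scale x ys) (0P ∷ (xs *L ys))))

    *L-assoc : ∀ xs ys zs → ((xs *L ys) *L zs) ≋L (xs *L (ys *L zs))
    *L-assoc []       ys zs = []
    *L-assoc (x ∷ xs) ys zs = begin
      (scale x ys +L (0P ∷ (xs *L ys))) *L zs
        ≈⟨ *L-distribʳ (scale x ys) (0P ∷ (xs *L ys)) zs ⟩
      (scale x ys *L zs) +L ((0P ∷ (xs *L ys)) *L zs)
        ≈⟨ +L-cong (scale-*L x ys zs) (0∷-*L (xs *L ys) zs) ⟩
      scale x (ys *L zs) +L (0P ∷ ((xs *L ys) *L zs))
        ≈⟨ +L-congˡ (scale x (ys *L zs)) (refl ∷ *L-assoc xs ys zs) ⟩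
      scale x (ys *L zs) +L (0P ∷ (xs *L (ys *L zs)))
        ∎
      where open SetoidReasoning ≋L-setoid

    *L-identityˡ : ∀ xs → ((constP 1# ∷ []) *L xs) ≋L xs
    *L-identityˡ xs = begin
      scale (constP 1#) xs +L (0P ∷ [])  ≈⟨ +L-congˡ (scale (constP 1#) xs) (≋[] refl []) ⟩
      scale (constP 1#) xs +L []         ≈⟨ +L-identityʳ (scale (constP 1#) xs) ⟩
      scale (constP 1#) xs               ≈⟨ scale-identity xs ⟩
      xs                                 ∎
      where open SetoidReasoning ≋L-setoid

    poly-isEquivalence : IsEquivalence (_≋_ {suc k})
    poly-isEquivalence = record
      { refl  = λ { {poly _} → poly≋ ≋L-refl }
      ; sym   = λ { {poly _} {poly _} e → poly≋ (≋L-sym (poly≋⁻¹ e)) }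
      ; trans = λ { {poly _} {poly _} {poly _} e f → poly≋ (≋L-trans (poly≋⁻¹ e) (poly≋⁻¹ f)) }
      }

    poly-isPolySemiring : IsPolySemiring (suc k)
    poly-isPolySemiring = isCommutativeSemiringˡ record
      { +-isCommutativeMonoid = isCommutativeMonoidˡ record
        { isSemigroup = record
          { isMagma = record
            { isEquivalence = poly-isEquivalence
            ; ∙-cong = λ { {poly _} {poly _} {poly _} {poly _} e f → poly≋ (+L-cong (poly≋⁻¹ e) (poly≋⁻¹ f)) }
            }
          ; assoc = λ { (poly p) (poly q) (poly r) → poly≋ (+L-assoc p q r) }
          }
        ; identityˡ = λ { (poly p) → poly≋ ≋L-refl }
        ; comm = λ { (poly p) (poly q) → poly≋ (+L-comm p q) }
        }
      ; *-isCommutativeMonoid = isCommutativeMonoidˡ record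
        { isSemigroup = record
          { isMagma = record
            { isEquivalence = poly-isEquivalence
            ; ∙-cong = λ { {poly _} {poly _} {poly _} {poly _} e f → poly≋ (*L-cong (poly≋⁻¹ e) (poly≋⁻¹ f)) }
            }
          ; assoc = λ { (poly p) (poly q) (poly r) → poly≋ (*L-assoc p q r) }
          }
        ; identityˡ = λ { (poly p) → poly≋ (*L-identityˡ p) }
        ; comm = λ { (poly p) (poly q) → poly≋ (*L-comm p q) }
        }
      ; distribʳ = λ { (poly p) (poly q) (poly r) → poly≋ (*L-distribʳ q r p) }
      ; zeroˡ = λ { (poly p) → poly≋ [] }
      }

    ≋L[]-head : ∀ {z : Poly k} {zs} → (z ∷ zs) ≋L [] → z ≋ 0P
    ≋L[]-head (≋[] z≈0 _) = z≈0

    ≋L[]-tail : ∀ {z : Poly k} {zs} → (z ∷ zs) ≋L [] → zs ≋L []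
    ≋L[]-tail (≋[] _ zs≈0) = zs≈0

    *L-0∷ : ∀ xs {y} ys → y ≋ 0P → (xs *L (y ∷ ys)) ≋L (0P ∷ (xs *L ys))
    *L-0∷ xs {y} ys y≈0 = ≋L-trans (*L-∷ xs y ys) (+L-congʳ (0P ∷ (xs *L ys)) (scale-zero xs y≈0))

    *L-noZeroDivisors : NoZeroDivisors k →
      ∀ (xs ys : List (Poly k)) → ¬ xs ≋L [] → ¬ ys ≋L [] → ¬ (xs *L ys) ≋L []
    *L-noZeroDivisors noZD []       ys       xs≉0 ys≉0 xsys≈0 = xs≉0 []
    *L-noZeroDivisors noZD (x ∷ xs) []       xs≉0 ys≉0 xsys≈0 = ys≉0 []
    -- If x or y vanished, the product would be 0 ∷ (a shorter nonzero product);
    -- so neither does, and then neither does the constant coefficient x y.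
    *L-noZeroDivisors noZD (x ∷ xs) (y ∷ ys) x∷xs≉0 y∷ys≉0 x∷xs*y∷ys≈0 = noZD
      (λ x≈0 → *L-noZeroDivisors noZD xs (y ∷ ys) (λ xs≈0 → x∷xs≉0 (≋[] x≈0 xs≈0)) y∷ys≉0
        (≋L-trans (≋L-sym (+L-congʳ (xs *L (y ∷ ys)) (scale-zero ys x≈0)))
                  (≋L[]-tail x∷xs*y∷ys≈0)))
      (λ y≈0 → *L-noZeroDivisors noZD (x ∷ xs) ys x∷xs≉0 (λ ys≈0 → y∷ys≉0 (≋[] y≈0 ys≈0))
        (≋L[]-tail (≋L-trans (≋L-sym (*L-0∷ (x ∷ xs) ys y≈0)) x∷xs*y∷ys≈0)))
      (trans (sym (+-identityʳ (x *P y))) (≋L[]-head x∷xs*y∷ys≈0))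

    poly-noZeroDivisors : NoZeroDivisors k → NoZeroDivisors (suc k)
    poly-noZeroDivisors noZD {poly p} {poly q} p≉0 q≉0 pq≈0 =
      *L-noZeroDivisors noZD p q (λ e → p≉0 (poly≋ e)) (λ e → q≉0 (poly≋ e)) (poly≋⁻¹ pq≈0)

    module _ (a : Carrier) where
      z+-*L : ∀ ts → (z+ a *L ts) ≋L (scale (constP a) ts +L (0P ∷ ts))
      z+-*L ts = +L-congˡ (scale (constP a) ts) (refl ∷ *L-identityˡ ts)

      -- The coefficients above the constant one are those of a·ts' + (t ∷ ts'),
      -- which has the same shape one degree lower.
      linearFactor-cancel : ∀ (x : Poly k) ts →
        ((x ∷ []) +L (scale (constP a) ts +L (0P ∷ ts))) ≋L [] → ts ≋L []
      linearFactor-cancel x []       _                = []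
      linearFactor-cancel x (t ∷ ts) (≋[] _ tail≈0) =
        ≋L-trans (≋L-sym (+L-congʳ (t ∷ ts) (scale-congˡ (constP a) ts≈0))) tail≈0
        where
        ts≈0 : ts ≋L []
        ts≈0 = linearFactor-cancel t ts (≋L-trans (begin
          (t ∷ []) +L (scale (constP a) ts +L (0P ∷ ts))  ≈⟨ x∙yz≈y∙xz (t ∷ []) (scale (constP a) ts) (0P ∷ ts) ⟩
          scale (constP a) ts +L ((t +P 0P) ∷ ts)          ≈⟨ +L-congˡ (scale (constP a) ts) (+-identityʳ t ∷ ≋L-refl) ⟩
          scale (constP a) ts +L (t ∷ ts)                  ∎) tail≈0)
          where open SetoidReasoning ≋L-setoid

      taylor-reflects-zero : ∀ xs → taylor a xs ≋L [] → xs ≋L []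
      taylor-reflects-zero []       _ = []
      taylor-reflects-zero (x ∷ xs) taylor≈0 =
        ≋[] (≋L[]-head (≋L-trans x∷[]≈taylor taylor≈0)) (taylor-reflects-zero xs T≈0)
        where
        T : List (Poly k)
        T = taylor a xs
        T≈0 : T ≋L []
        T≈0 = linearFactor-cancel x T
          (≋L-trans (≋L-sym (+L-congˡ (x ∷ []) (z+-*L T))) taylor≈0)
        x∷[]≈taylor : (x ∷ []) ≋L taylor a (x ∷ xs)
        x∷[]≈taylor = ≋L-sym (+L-congˡ (x ∷ [])
          (≋L-trans (*L-cong (≋L-refl {z+ a}) T≈0) (*L-zeroʳ (z+ a))))

  isPolySemiring : ∀ k → IsPolySemiring k
  isPolySemiring zero    = constant-isPolySemiring
  isPolySemiring (suc k) = CoefficientLists.poly-isPolySemiring (isPolySemiring k)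

  noZeroDivisors : ∀ k → NoZeroDivisors k
  noZeroDivisors zero    = constant-noZeroDivisors
  noZeroDivisors (suc k) = CoefficientLists.poly-noZeroDivisors (isPolySemiring k) (noZeroDivisors k)

  Compatible-diagonal : ∀ {k} (A : Vec ℤ k → Poly k) → Compatible A A
  Compatible-diagonal {k} A v w = ≋⇒≈P (begin
    X *P (Y *P (Z *P W))  ≈⟨ *-assoc X Y (Z *P W) ⟨
    (X *P Y) *P (Z *P W)  ≈⟨ *-comm (X *P Y) (Z *P W) ⟩
    (Z *P W) *P (X *P Y)  ≈⟨ *-assoc Z W (X *P Y) ⟩
    Z *P (W *P (X *P Y))  ∎)
    where
    open IsCommutativeSemiring (isPolySemiring k) using (*-assoc; *-comm; setoid)
    open SetoidReasoning setoid
    X Y Z W : Poly k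
    X = A v
    Y = shiftP (A w) v
    Z = A w
    W = shiftP (A v) w

  mutual
    shiftP-reflects-zero : ∀ {k} (p : Poly k) v → shiftP p v ≋ 0P → p ≋ 0P
    shiftP-reflects-zero (con x)  []      p^v≈0 = p^v≈0
    shiftP-reflects-zero {suc k} (poly ps) (c ∷ v) p^v≈0 = poly≋ (shiftL-reflects-zero ps v
      (CoefficientLists.taylor-reflects-zero (isPolySemiring k) (ι c) (shiftL ps v) (poly≋⁻¹ p^v≈0)))

    shiftL-reflects-zero : ∀ {k} (ps : List (Poly k)) v → shiftL ps v ≋L [] → ps ≋L []
    shiftL-reflects-zero []       v []             = []
    shiftL-reflects-zero (p ∷ ps) v (≋[] e es) =
      ≋[] (shiftP-reflects-zero p v e) (shiftL-reflects-zero ps v es)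

  module Evaluation where
    open F
    open SetoidReasoning setoid
    open CommutativeSemigroupProperties +-commutativeSemigroup using (interchange)

    evalP-0P : ∀ {k} (xs : Vec Carrier k) → evalP 0P xs ≈ 0#
    evalP-0P []       = refl
    evalP-0P (x ∷ xs) = refl

    evalP-constP : ∀ {k} a (xs : Vec Carrier k) → evalP (constP a) xs ≈ a
    evalP-constP a []       = refl
    evalP-constP a (x ∷ xs) = trans (+-cong (evalP-constP a xs) (zeroʳ x)) (+-identityʳ a)

    mutual
      evalP-+P : ∀ {k} (p q : Poly k) xs → evalP (p +P q) xs ≈ evalP p xs + evalP q xs
      evalP-+P (con x)  (con y)  []       = refl
      evalP-+P (poly p) (poly q) (x ∷ xs) = evalL-+L p q x xs

      evalL-+L : ∀ {k} (ps qs : List (Poly k)) x xs →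
        evalL (ps +L qs) x xs ≈ evalL ps x xs + evalL qs x xs
      evalL-+L []       qs       x xs = sym (+-identityˡ _)
      evalL-+L (p ∷ ps) []       x xs = sym (+-identityʳ _)
      evalL-+L (p ∷ ps) (q ∷ qs) x xs = begin
        evalP (p +P q) xs + x * evalL (ps +L qs) x xs
          ≈⟨ +-cong (evalP-+P p q xs) (*-congˡ (evalL-+L ps qs x xs)) ⟩
        (evalP p xs + evalP q xs) + x * (evalL ps x xs + evalL qs x xs)
          ≈⟨ +-congˡ (distribˡ x _ _) ⟩
        (evalP p xs + evalP q xs) + (x * evalL ps x xs + x * evalL qs x xs)
          ≈⟨ interchange _ _ _ _ ⟩
        (evalP p xs + x * evalL ps x xs) + (evalP q xs + x * evalL qs x xs)
          ∎

    mutual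
      evalP-*P : ∀ {k} (p q : Poly k) xs → evalP (p *P q) xs ≈ evalP p xs * evalP q xs
      evalP-*P (con x)  (con y)  []       = refl
      evalP-*P (poly p) (poly q) (x ∷ xs) = evalL-*L p q x xs

      evalL-*L : ∀ {k} (ps qs : List (Poly k)) x xs →
        evalL (ps *L qs) x xs ≈ evalL ps x xs * evalL qs x xs
      evalL-*L []       qs x xs = sym (zeroˡ _)
      evalL-*L (p ∷ ps) qs x xs = begin
        evalL (scale p qs +L (0P ∷ (ps *L qs))) x xs
          ≈⟨ evalL-+L (scale p qs) (0P ∷ (ps *L qs)) x xs ⟩
        evalL (scale p qs) x xs + (evalP 0P xs + x * evalL (ps *L qs) x xs)
          ≈⟨ +-cong (evalL-scale p qs x xs) (+-cong (evalP-0P xs) (*-congˡ (evalL-*L ps qs x xs))) ⟩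
        evalP p xs * evalL qs x xs + (0# + x * (evalL ps x xs * evalL qs x xs))
          ≈⟨ +-congˡ (trans (+-identityˡ _) (sym (*-assoc x _ _))) ⟩
        evalP p xs * evalL qs x xs + x * evalL ps x xs * evalL qs x xs
          ≈⟨ distribʳ _ _ _ ⟨
        (evalP p xs + x * evalL ps x xs) * evalL qs x xs
          ∎

      evalL-scale : ∀ {k} (p : Poly k) qs x xs →
        evalL (scale p qs) x xs ≈ evalP p xs * evalL qs x xs
      evalL-scale p []       x xs = sym (zeroʳ _)
      evalL-scale p (q ∷ qs) x xs = begin
        evalP (p *P q) xs + x * evalL (scale p qs) x xs
          ≈⟨ +-cong (evalP-*P p q xs) (*-congˡ (evalL-scale p qs x xs)) ⟩
        evalP p xs * evalP q xs + x * (evalP p xs * evalL qs x xs)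
          ≈⟨ +-congˡ (x∙yz≈y∙xz x _ _) ⟩
        evalP p xs * evalP q xs + evalP p xs * (x * evalL qs x xs)
          ≈⟨ distribˡ _ _ _ ⟨
        evalP p xs * (evalP q xs + x * evalL qs x xs)
          ∎
        where open CommutativeSemigroupProperties *-commutativeSemigroup using (x∙yz≈y∙xz)

    mutual
      evalP-cong : ∀ {k} (p : Poly k) {xs ys} → Pointwise _≈_ xs ys → evalP p xs ≈ evalP p ys
      evalP-cong (con x)  []       = refl
      evalP-cong (poly p) (e ∷ es) = evalL-cong p e es

      evalL-cong : ∀ {k} (ps : List (Poly k)) {x y xs ys} → x ≈ y → Pointwise _≈_ xs ys →
        evalL ps x xs ≈ evalL ps y ys
      evalL-cong []       e es = refl
      evalL-cong (p ∷ ps) e es = +-cong (evalP-cong p es) (*-cong e (evalL-cong ps e es))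

    evalL-z+ : ∀ {k} a x (xs : Vec Carrier k) → evalL (z+ a) x xs ≈ a + x
    evalL-z+ a x xs = +-cong (evalP-constP a xs)
      (trans (*-congˡ (trans (+-cong (evalP-constP 1# xs) (zeroʳ x)) (+-identityʳ 1#))) (*-identityʳ x))

    evalL-taylor : ∀ {k} a (ps : List (Poly k)) x xs → evalL (taylor a ps) x xs ≈ evalL ps (a + x) xs
    evalL-taylor a []       x xs = refl
    evalL-taylor a (p ∷ ps) x xs = begin
      evalL ((p ∷ []) +L (z+ a *L taylor a ps)) x xs
        ≈⟨ evalL-+L (p ∷ []) (z+ a *L taylor a ps) x xs ⟩
      evalL (p ∷ []) x xs + evalL (z+ a *L taylor a ps) x xs
        ≈⟨ +-cong (trans (+-congˡ (zeroʳ x)) (+-identityʳ _)) (evalL-*L (z+ a) (taylor a ps) x xs) ⟩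
      evalP p xs + evalL (z+ a) x xs * evalL (taylor a ps) x xs
        ≈⟨ +-congˡ (*-cong (evalL-z+ a x xs) (evalL-taylor a ps x xs)) ⟩
      evalP p xs + (a + x) * evalL ps (a + x) xs
        ∎

    mutual
      evalP-shiftP : ∀ {k} (p : Poly k) v xs →
        evalP (shiftP p v) xs ≈ evalP p (zipWith _+_ (map ι v) xs)
      evalP-shiftP (con x)  []      []       = refl
      evalP-shiftP (poly p) (c ∷ v) (x ∷ xs) =
        trans (evalL-taylor (ι c) (shiftL p v) x xs) (evalL-shiftL p v (ι c + x) xs)

      evalL-shiftL : ∀ {k} (ps : List (Poly k)) v y xs →
        evalL (shiftL ps v) y xs ≈ evalL ps y (zipWith _+_ (map ι v) xs)
      evalL-shiftL []       v y xs = refl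
      evalL-shiftL (p ∷ ps) v y xs = +-cong (evalP-shiftP p v xs) (*-congˡ (evalL-shiftL ps v y xs))

    ιℕ-+ : ∀ m n → ιℕ (m ℕ.+ n) ≈ ιℕ m + ιℕ n
    ιℕ-+ zero    n = sym (+-identityˡ _)
    ιℕ-+ (suc m) n = trans (+-congˡ (ιℕ-+ m n)) (sym (+-assoc 1# _ _))

    ι-⊖ : ∀ m n → ι (m ⊖ n) ≈ ιℕ m - ιℕ n
    ι-⊖ m       zero    = sym (trans (+-congˡ (ε⁻¹≈ε +-group)) (+-identityʳ _))
    ι-⊖ zero    (suc n) = sym (+-identityˡ _)
    ι-⊖ (suc m) (suc n) rewrite ℤ.[1+m]⊖[1+n]≡m⊖n m n = begin
      ι (m ⊖ n)                        ≈⟨ ι-⊖ m n ⟩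
      ιℕ m - ιℕ n                      ≈⟨ +-identityˡ _ ⟨
      0# + (ιℕ m - ιℕ n)               ≈⟨ +-congʳ (-‿inverseʳ 1#) ⟨
      (1# - 1#) + (ιℕ m - ιℕ n)        ≈⟨ interchange _ _ _ _ ⟩
      (1# + ιℕ m) + (- 1# - ιℕ n)      ≈⟨ +-congˡ (⁻¹-∙-comm +-abelianGroup 1# (ιℕ n)) ⟩
      (1# + ιℕ m) - (1# + ιℕ n)        ∎

    ι-+ : ∀ a b → ι (a ℤ.+ b) ≈ ι a + ι b
    ι-+ (+ m)    (+ n)    = ιℕ-+ m n
    ι-+ (+ m)    -[1+ n ] = ι-⊖ m (suc n)
    ι-+ -[1+ m ] (+ n)    = trans (ι-⊖ n (suc m)) (+-comm _ _)
    ι-+ -[1+ m ] -[1+ n ] = begin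
      - (1# + ιℕ (suc (m ℕ.+ n)))      ≈⟨ -‿cong (+-congˡ (reflexive (≡.cong ιℕ (ℕ.+-suc m n)))) ⟨
      - ιℕ (suc m ℕ.+ suc n)           ≈⟨ -‿cong (ιℕ-+ (suc m) (suc n)) ⟩
      - (ιℕ (suc m) + ιℕ (suc n))      ≈⟨ ⁻¹-∙-comm +-abelianGroup _ _ ⟨
      ι -[1+ m ] + ι -[1+ n ]          ∎

    ι-+ᵛ : ∀ {k} (v z : Vec ℤ k) → Pointwise _≈_ (zipWith _+_ (map ι v) (map ι z)) (map ι (z +ᵛ v))
    ι-+ᵛ []      []      = []
    ι-+ᵛ (a ∷ v) (b ∷ z) = trans (+-comm (ι a) (ι b)) (sym (ι-+ b a)) ∷ ι-+ᵛ v z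

    evalℤ-shiftP : ∀ {k} (p : Poly k) v z → evalℤ (shiftP p v) z ≈ evalℤ p (z +ᵛ v)
    evalℤ-shiftP p v z = trans (evalP-shiftP p v (map ι z)) (evalP-cong p (ι-+ᵛ v z))

  Annihilates : ∀ {k} → Poly k → (Vec ℤ k → Carrier) → Set ℓ
  Annihilates p g = ∀ z → (evalℤ p z F.* g z) F.≈ 0#

  module _ {k : ℕ} where
    open F using (_≈_; _*_; trans; sym; *-congˡ; *-congʳ; *-assoc; *-comm; zeroʳ)
    open Evaluation using (evalP-*P; evalℤ-shiftP)
    open SetoidReasoning F.setoid

    *P-annihilatesˡ : ∀ (p q : Poly k) {g} → Annihilates p g → Annihilates (p *P q) g
    *P-annihilatesˡ p q {g} pg≈0 z = begin
      evalℤ (p *P q) z * g z          ≈⟨ *-congʳ (trans (evalP-*P p q (map ι z)) (*-comm _ _)) ⟩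
      evalℤ q z * evalℤ p z * g z     ≈⟨ *-assoc _ _ _ ⟩
      evalℤ q z * (evalℤ p z * g z)   ≈⟨ *-congˡ (pg≈0 z) ⟩
      evalℤ q z * 0#                  ≈⟨ zeroʳ _ ⟩
      0#                              ∎

    *P-annihilatesʳ : ∀ (p q : Poly k) {g} → Annihilates q g → Annihilates (p *P q) g
    *P-annihilatesʳ p q {g} qg≈0 z = begin
      evalℤ (p *P q) z * g z          ≈⟨ *-congʳ (evalP-*P p q (map ι z)) ⟩
      evalℤ p z * evalℤ q z * g z     ≈⟨ *-assoc _ _ _ ⟩
      evalℤ p z * (evalℤ q z * g z)   ≈⟨ *-congˡ (qg≈0 z) ⟩
      evalℤ p z * 0#                  ≈⟨ zeroʳ _ ⟩
      0#                              ∎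

    shiftP-annihilates : ∀ (p : Poly k) {g} v → Annihilates p g →
      Annihilates (shiftP p v) (λ z → g (z +ᵛ v))
    shiftP-annihilates p v pg≈0 z = trans (*-congʳ (evalℤ-shiftP p v z)) (pg≈0 (z +ᵛ v))

    annihilators-relate : ∀ (A B : Poly k) {f} v →
      Annihilates A f → Annihilates B (λ z → f (z +ᵛ v)) → Relates f A B v
    annihilators-relate A B v Af≈0 Bf^v≈0 z = trans (Af≈0 z) (sym (Bf^v≈0 z))

    *P-shiftP-nonzero : ∀ (p : Poly k) → NonzeroP p → ∀ v → NonzeroP (p *P shiftP p v)
    *P-shiftP-nonzero p p≉0 v pp^v≈0 = noZeroDivisors k {p} {shiftP p v}
      (λ p≈0 → p≉0 (≋⇒≈P p≈0))
      (λ p^v≈0 → p≉0 (≋⇒≈P (shiftP-reflects-zero p v p^v≈0)))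
      (≈P⇒≋ pp^v≈0)

propositionB8 : {c ℓ : Level} (K : Field c ℓ) (k : ℕ) (f : Vec ℤ k → Field.Carrier K) →
    FieldPoly.IsHypergeometric K f → FieldPoly.IsZeroDivisor K f →
    Σ (Vec ℤ k → FieldPoly.Poly K k) λ A → Σ (Vec ℤ k → FieldPoly.Poly K k) λ B →
      ((v : Vec ℤ k) → FieldPoly.NonzeroP K (A v) × FieldPoly.NonzeroP K (B v)
        × FieldPoly.Relates K f (A v) (B v) v)
      × FieldPoly.Compatible K A B
propositionB8 K k f _ (p , p≉0 , pf≈0) = A , A , A-properties , Compatible-diagonal K A
  where
  open FieldPoly K
  A : Vec ℤ k → Poly k
  A v = p *P shiftP p v

  A-properties : ∀ v → NonzeroP (A v) × NonzeroP (A v) × Relates f (A v) (A v) v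
  A-properties v = A≉0 , A≉0 , annihilators-relate K (A v) (A v) v
      (*P-annihilatesˡ K p (shiftP p v) pf≈0)
      (*P-annihilatesʳ K p (shiftP p v) (shiftP-annihilates K p v pf≈0))
    where
    A≉0 : NonzeroP (A v)
    A≉0 = *P-shiftP-nonzero K p p≉0 v
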